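{- For any string $S$ and any position $1 \leq u \leq |S|$, $|f^{ -1}(u)| \leq 2$.
   Context: For a string $S$ of length $n$ and $1 \le i \le j \le n$, $S[i..j]$ is the substring from position $i$ to position $j$; a non-empty substring is unique if it occurs exactly once in $S$ and repeating if it occurs at least twice; an interval $[i,j]$ is unique/repeating according to $S[i..j]$. An interval $[i,j]$ is a minimal unique substring (MUS) if $S[i..j]$ is unique and every proper substring $S[i'..j']$ ($i\le i'$, $j'\le j$, $j'-i'<j-i$) is repeating; $\mathcal{M}_S$ is the set of all MUS intervals. $[s,t]\subset[i,j]$ means $i\le s$ and $t\le j$. An interval $[i,j]$ is a shortest unique substring (SUS) for $[s,t]$ if $S[i..j]$ is unique, $[s,t]\subset[i,j]$, and $S[i'..j']$ is repeating for every $[i',j']\supset[s,t]$ with $j'-i'<j-i$. $\mathsf{SUS}_S(p)$ is the set of SUSs for $[p,p]$ and $\mathcal{PS}_S=\bigcup_{p=1}^n\mathsf{SUS}_S(p)$. Let $\mathcal{LS}_S=\mathcal{PS}_S\cap\{[x,y]\notin\mathcal{M}_S : \exists i,\ x<i\le y,\ [i,y]\in\mathcal{M}_S\}$, $\mathcal{MS}_S=\mathcal{PS}_S\cap\mathcal{M}_S$, and $\mathcal{RS}_S=\mathcal{PS}_S\cap\{[x,y]\notin\mathcal{M}_S : \exists j,\ x\le j<y,\ [x,j]\in\mathcal{M}_S\}$; these three sets are pairwise disjoint and their union is $\mathcal{PS}_S$. Define $f:\mathcal{PS}_S\to\{1,\dots,n\}$ by $f([x,y])=x$ if $[x,y]\in\mathcal{LS}_S\cup\mathcal{MS}_S$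 and $f([x,y])=y$ if $[x,y]\in\mathcal{RS}_S$, and $f^{ -1}(u)=\{[x,y]\in\mathcal{PS}_S : f([x,y])=u\}$. -}

module Defs where

open import Data.Nat using (ℕ; zero; suc; _+_; _∸_; _≤_; _<_)
open import Data.List using (List; []; _∷_; length)
open import Data.Maybe using (Maybe; just; nothing)
open import Data.Product using (_×_; Σ; ∃; _,_)
open import Data.Sum using (_⊎_)
open import Relation.Nullary using (¬_)
open import Relation.Binary.PropositionalEquality using (_≡_; _≢_)

-- Intervals [i,j] are pairs of 1-indexed positions.
Interval : Set
Interval = ℕ × ℕ

-- 1-indexed character access: at S p = just S[p] for 1 ≤ p ≤ |S|.
at : {A : Set} → List A → ℕ → Maybe A
at []       _             = nothing
at (x ∷ xs) zero          = nothing
at (x ∷ xs) (suc zero)    = just x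
at (x ∷ xs) (suc (suc k)) = at xs (suc k)

module _ {A : Set} (S : List A) where

  Valid : Interval → Set
  Valid (i , j) = (1 ≤ i) × (i ≤ j) × (j ≤ length S)

  OccursAt : Interval → ℕ → Set
  OccursAt (i , j) k =
    (1 ≤ k) × (k + (j ∸ i) ≤ length S) ×
    (∀ d → d ≤ j ∸ i → at S (k + d) ≡ at S (i + d))

  Unique : Interval → Set
  Unique (i , j) = Valid (i , j) × (∀ k → OccursAt (i , j) k → k ≡ i)

  Repeating : Interval → Set
  Repeating (i , j) = Valid (i , j) × ∃ λ k → OccursAt (i , j) k × (k ≢ i)

  MUS : Interval → Set
  MUS (i , j) = Unique (i , j) ×
    (∀ i' j' → i ≤ i' → i' ≤ j' → j' ≤ j → j' ∸ i' < j ∸ i → Repeating (i' , j'))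

  SUS : Interval → Interval → Set
  SUS (s , t) (i , j) = Unique (i , j) × (i ≤ s) × (t ≤ j) ×
    (∀ i' j' → Valid (i' , j') → i' ≤ s → t ≤ j' → j' ∸ i' < j ∸ i → Repeating (i' , j'))

  PS : Interval → Set
  PS x = ∃ λ p → (1 ≤ p) × (p ≤ length S) × SUS (p , p) x

  LS : Interval → Set
  LS (x , y) = PS (x , y) × ¬ MUS (x , y) × ∃ λ i → (x < i) × (i ≤ y) × MUS (i , y)

  MS : Interval → Set
  MS I = PS I × MUS I

  RS : Interval → Set
  RS (x , y) = PS (x , y) × ¬ MUS (x , y) × ∃ λ j → (x ≤ j) × (j < y) × MUS (x , j)

  -- [x,y] ∈ f⁻¹(u), where f([x,y]) = x on LS ∪ MS and f([x,y]) = y on RS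
  -- (LS, MS, RS partition PS, so this is exactly the preimage of u under f).
  FInv : ℕ → Interval → Set
  FInv u (x , y) = ((LS (x , y) ⊎ MS (x , y)) × (x ≡ u)) ⊎ (RS (x , y) × (y ≡ u))

module Submission where

-- Every member of f⁻¹(u) is either a "left" interval [u,y]
-- (in LS ∪ MS, so f picks its left end) or a "right" interval [x,u] (in RS,
-- so f picks its right end).  We show that there is at most one left and at
-- most one right member; by pigeonhole, among three members two coincide.
--
-- The combinatorial core consists of two general facts:
--   * uniqueness is inherited by superintervals: an occurrence of S[c..d]
--     restricts to an occurrence of any S[a..b] with [a,b] ⊂ [c,d], so if
--     [a,b] is unique then [c,d] cannot be repeating;
--   * hence a SUS [x,y] for p contains no unique [a,b] such that some
--     interval covering both [a,b] and p inside [x,y] is strictly shorter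
--     than [x,y] (that interval would be both repeating and unique).
-- Two left intervals [x,y₁], [x,y₂] with y₁ < y₂ (resp. two right intervals
-- [x₁,y], [x₂,y] with x₁ < x₂) are refuted by exhibiting such a covering
-- interval, found by comparing the position p with the MUS witnessing that
-- the longer interval lies in LS (resp. the shorter one lies in RS).

open import Defs
open import Data.Nat using (ℕ; _≤_; _<_; _+_; _∸_; _⊔_; _⊓_; _≤?_)
open import Data.Nat.Properties
open import Data.List using (List; length)
open import Data.Sum using (_⊎_; inj₁; inj₂)
open import Data.Product using (_×_; _,_; proj₁; proj₂)
open import Data.Empty using (⊥; ⊥-elim)
open import Relation.Nullary using (yes; no)
open import Relation.Binary using (tri<; tri≈; tri>)
open import Relation.Binary.PropositionalEquality

pigeonhole-two : {X : Set} (L R : X → Set) →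
                 (∀ {a b} → L a → L b → a ≡ b) → (∀ {a b} → R a → R b → a ≡ b) →
                 {a b c : X} → L a ⊎ R a → L b ⊎ R b → L c ⊎ R c →
                 (a ≡ b) ⊎ (a ≡ c) ⊎ (b ≡ c)
pigeonhole-two L R atMostOneL atMostOneR = go
  where
    go : ∀ {a b c} → L a ⊎ R a → L b ⊎ R b → L c ⊎ R c → (a ≡ b) ⊎ (a ≡ c) ⊎ (b ≡ c)
    go (inj₁ la) (inj₁ lb) _         = inj₁ (atMostOneL la lb)
    go (inj₂ ra) (inj₂ rb) _         = inj₁ (atMostOneR ra rb)
    go (inj₁ la) (inj₂ _)  (inj₁ lc) = inj₂ (inj₁ (atMostOneL la lc))
    go (inj₁ _)  (inj₂ rb) (inj₂ rc) = inj₂ (inj₂ (atMostOneR rb rc))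
    go (inj₂ _)  (inj₁ lb) (inj₁ lc) = inj₂ (inj₂ (atMostOneL lb lc))
    go (inj₂ ra) (inj₁ _)  (inj₂ rc) = inj₂ (inj₁ (atMostOneR ra rc))

no-strict-pair⇒≡ : (P : ℕ → Set) → (∀ {m n} → P m → P n → m < n → ⊥) →
                   ∀ {m n} → P m → P n → m ≡ n
no-strict-pair⇒≡ P noPair {m} {n} pm pn with <-cmp m n
... | tri< m<n _ _ = ⊥-elim (noPair pm pn m<n)
... | tri≈ _ m≡n _ = m≡n
... | tri> _ _ n<m = ⊥-elim (noPair pn pm n<m)

offset-split : ∀ {i i' j'} → i ≤ i' → i' ≤ j' → (i' ∸ i) + (j' ∸ i') ≡ j' ∸ i
offset-split {i} {i'} {j'} i≤i' i'≤j' = +-cancelˡ-≡ i _ _ (begin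
  i + ((i' ∸ i) + (j' ∸ i'))   ≡⟨ sym (+-assoc i (i' ∸ i) (j' ∸ i')) ⟩
  (i + (i' ∸ i)) + (j' ∸ i')   ≡⟨ cong (_+ (j' ∸ i')) (m+[n∸m]≡n i≤i') ⟩
  i' + (j' ∸ i')               ≡⟨ m+[n∸m]≡n i'≤j' ⟩
  j'                           ≡⟨ sym (m+[n∸m]≡n (≤-trans i≤i' i'≤j')) ⟩
  i + (j' ∸ i)                 ∎)
  where open ≡-Reasoning

module _ {A : Set} (S : List A) where

  occursAt-sub : ∀ {i j i' j' k} → i ≤ i' → i' ≤ j' → j' ≤ j →
                 OccursAt S (i , j) k → OccursAt S (i' , j') (k + (i' ∸ i))
  occursAt-sub {i} {j} {i'} {j'} {k} i≤i' i'≤j' j'≤j (1≤k , end≤n , agree) =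
    ≤-trans 1≤k (m≤m+n k a) , end'≤n , agree'
    where
      a = i' ∸ i
      span≤ : a + (j' ∸ i') ≤ j ∸ i
      span≤ = subst (_≤ j ∸ i) (sym (offset-split i≤i' i'≤j')) (∸-monoˡ-≤ i j'≤j)
      end'≤n : k + a + (j' ∸ i') ≤ length S
      end'≤n = subst (_≤ length S) (sym (+-assoc k a (j' ∸ i')))
                     (≤-trans (+-monoʳ-≤ k span≤) end≤n)
      agree' : ∀ d → d ≤ j' ∸ i' → at S (k + a + d) ≡ at S (i' + d)
      agree' d d≤ = subst₂ (λ x y → at S x ≡ at S y)
                      (sym (+-assoc k a d))
                      (trans (sym (+-assoc i a d)) (cong (_+ d) (m+[n∸m]≡n i≤i')))
                      (agree (a + d) (≤-trans (+-monoʳ-≤ a d≤) span≤))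

  unique⇒¬repeating : ∀ {I} → Unique S I → Repeating S I → ⊥
  unique⇒¬repeating (_ , onlyAt) (_ , k , occ , k≢) = k≢ (onlyAt k occ)

  unique⊂⇒¬repeating : ∀ {a b c d} → Unique S (a , b) → c ≤ a → b ≤ d →
                       Repeating S (c , d) → ⊥
  unique⊂⇒¬repeating {a} {b} {c} ((_ , a≤b , _) , onlyAt) c≤a b≤d (_ , k , occ , k≢c) =
    k≢c (+-cancelʳ-≡ (a ∸ c) k c
          (trans (onlyAt _ (occursAt-sub c≤a a≤b b≤d occ)) (sym (m+[n∸m]≡n c≤a))))

  sus-no-shorter-cover : ∀ {p x y a b c d} → SUS S (p , p) (x , y) → Unique S (a , b) →
                         x ≤ c → c ≤ a → c ≤ p → b ≤ d → p ≤ d → d ≤ y →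
                         d ∸ c < y ∸ x → ⊥
  sus-no-shorter-cover (((1≤x , _ , y≤n) , _) , _ , _ , minimal) uab x≤c c≤a c≤p b≤d p≤d d≤y shorter =
    unique⊂⇒¬repeating uab c≤a b≤d
      (minimal _ _ (≤-trans 1≤x x≤c , ≤-trans c≤p p≤d , ≤-trans d≤y y≤n) c≤p p≤d shorter)

  PS⇒unique : ∀ {I} → PS S I → Unique S I
  PS⇒unique (_ , _ , _ , uniq , _) = uniq

  -- Intervals mapped by f to their left end.
  LeftPS : Interval → Set
  LeftPS I = LS S I ⊎ MS S I

  LeftPS⇒unique : ∀ {I} → LeftPS I → Unique S I
  LeftPS⇒unique (inj₁ (ps , _)) = PS⇒unique ps
  LeftPS⇒unique (inj₂ (ps , _)) = PS⇒unique ps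

  -- If the longer one [x,y₂] is a MUS, its proper prefix [x,y₁] is
  -- repeating.  If it lies in LS as a SUS for p with a MUS [i,y₂], x < i,
  -- then either i ≤ p and [i,y₂] is a shorter unique cover of p, or p < i and
  -- [x, y₁ ⊔ p] is a shorter cover of p containing the unique [x,y₁].
  left-no-longer : ∀ {x y₁ y₂} → LeftPS (x , y₁) → LeftPS (x , y₂) → y₁ < y₂ → ⊥
  left-no-longer {x} {y₁} {y₂} l₁ (inj₂ (_ , _ , properRepeating)) y₁<y₂ =
    unique⇒¬repeating u₁ (properRepeating x y₁ ≤-refl x≤y₁ (<⇒≤ y₁<y₂) (∸-monoˡ-< y₁<y₂ x≤y₁))
    where
      u₁ = LeftPS⇒unique l₁
      x≤y₁ = proj₁ (proj₂ (proj₁ u₁))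
  left-no-longer {x} {y₁} {y₂} l₁ (inj₁ ((p , _ , _ , sus) , _ , i , x<i , i≤y₂ , (uMUS , _))) y₁<y₂
    with sus | i ≤? p
  ... | (_ , _ , p≤y₂ , _) | yes i≤p =
    sus-no-shorter-cover sus uMUS (<⇒≤ x<i) ≤-refl i≤p ≤-refl p≤y₂ ≤-refl (∸-monoʳ-< x<i i≤y₂)
  ... | (_ , x≤p , p≤y₂ , _) | no i≰p =
    sus-no-shorter-cover sus u₁ ≤-refl ≤-refl x≤p (m≤m⊔n y₁ p) (m≤n⊔m y₁ p)
      (⊔-lub (<⇒≤ y₁<y₂) p≤y₂)
      (∸-monoˡ-< (⊔-pres-<m y₁<y₂ (<-≤-trans (≰⇒> i≰p) i≤y₂)) (≤-trans x≤y₁ (m≤m⊔n y₁ p)))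
    where
      u₁ = LeftPS⇒unique l₁
      x≤y₁ = proj₁ (proj₂ (proj₁ u₁))

  -- Symmetrically, a right interval [x₁,y] (a SUS for p with a MUS [x₁,j],
  -- j < y) admits no unique [x₂,y] with x₁ < x₂: either p ≤ j and [x₁,j] is
  -- a shorter unique cover of p, or j < p and [x₂ ⊓ p, y] is a shorter cover
  -- of p containing the unique [x₂,y].
  right-no-shorter : ∀ {x₁ x₂ y} → RS S (x₁ , y) → Unique S (x₂ , y) → x₁ < x₂ → ⊥
  right-no-shorter {x₁} {x₂} {y} ((p , _ , _ , sus) , _ , j , x₁≤j , j<y , (uMUS , _)) u₂ x₁<x₂
    with sus | p ≤? j
  ... | (_ , x₁≤p , _ , _) | yes p≤j =
    sus-no-shorter-cover sus uMUS ≤-refl ≤-refl x₁≤p ≤-refl p≤j (<⇒≤ j<y) (∸-monoˡ-< j<y x₁≤j)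
  ... | (_ , x₁≤p , p≤y , _) | no p≰j =
    sus-no-shorter-cover sus u₂ (⊓-glb (<⇒≤ x₁<x₂) x₁≤p) (m⊓n≤m x₂ p) (m⊓n≤n x₂ p)
      ≤-refl p≤y ≤-refl
      (∸-monoʳ-< (⊓-pres-m< x₁<x₂ (≤-<-trans x₁≤j (≰⇒> p≰j))) (≤-trans (m⊓n≤n x₂ p) p≤y))

  LeftPreimage : ℕ → Interval → Set
  LeftPreimage u (x , y) = LeftPS (x , y) × (x ≡ u)

  RightPreimage : ℕ → Interval → Set
  RightPreimage u (x , y) = RS S (x , y) × (y ≡ u)

  LeftPreimage-atMostOne : ∀ {u a b} → LeftPreimage u a → LeftPreimage u b → a ≡ b
  LeftPreimage-atMostOne {a = x , _} {_ , _} (l₁ , refl) (l₂ , refl) =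
    cong (x ,_) (no-strict-pair⇒≡ (λ y → LeftPS (x , y)) left-no-longer l₁ l₂)

  RightPreimage-atMostOne : ∀ {u a b} → RightPreimage u a → RightPreimage u b → a ≡ b
  RightPreimage-atMostOne {a = _ , y} {_ , _} (r₁ , refl) (r₂ , refl) =
    cong (_, y) (no-strict-pair⇒≡ (λ x → RS S (x , y))
                   (λ r r' → right-no-shorter r (PS⇒unique (proj₁ r'))) r₁ r₂)

lemma3 : {A : Set} (S : List A) (u : ℕ) → 1 ≤ u → u ≤ length S →
         (a b c : Interval) → FInv S u a → FInv S u b → FInv S u c →
         (a ≡ b) ⊎ (a ≡ c) ⊎ (b ≡ c)
lemma3 S u _ _ (_ , _) (_ , _) (_ , _) =
  pigeonhole-two (LeftPreimage S u) (RightPreimage S u)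
    (LeftPreimage-atMostOne S) (RightPreimage-atMostOne S)
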